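{- Let $A$ be an integral domain of characteristic zero, $H_A$ a free $A$-module of rank $2g$ with a unimodular skew-symmetric form. Then the short exact sequence of $\mathrm{GSp}(H_A)$-modules $$0 \to A(1) \xrightarrow{\check\theta} \Lambda^2 H_A \to \Lambda^2_0 H_A \to 0$$ splits if and only if $g \in A^\times$, and the short exact sequence of $\mathrm{GSp}(H_A)$-modules $$0 \to H_A \xrightarrow{\check\theta\wedge} (\Lambda^3 H_A)(-1) \to \Lambda^3_0 H_A \to 0$$ splits if and only if $g - 1 \in A^\times$.
   Context: $\mathrm{GSp}(H_A)$ is the group of $A$-linear automorphisms $\phi$ of $H_A$ with $\phi^*\beta = \tau(\phi)\beta$ for some $\tau(\phi) \in A^\times$, where $\beta$ is the form. $A(r)$ is the free rank one $A$-module on which $\mathrm{GSp}(H_A)$ acts by $\tau^r$, and $V(r) = V\otimes_A A(r)$. The map $\check\theta : A(1) \to \Lambda^2 H_A$ is the equivariant map dual to the form, sending the generator to $\sum_{i=1}^g a_i \wedge b_i$ for a symplectic basis $a_i, b_i$ ($\beta(a_i,b_j)=\delta_{ij}$, $\beta(a_i,a_j)=\beta(b_i,b_j)=0$); $\check\theta\wedge : H_A \to (\Lambda^3 H_A)(-1)$ is $x \mapsto \check\theta\wedge x$. $\Lambda^2_0 H_A = \Lambda^2 H_A/\mathrm{im}\,\check\theta$ and $\Lambda^3_0 H_A = (\Lambda^3 H_A)(-1)/(\check\theta\wedge H_A)$. Splitting means splitting in the category of $\mathrm{GSp}(H_A)$-modules. -}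

module Defs where

open import Level using (_⊔_)
open import Algebra.Bundles using (CommutativeRing; Semiring)
open import Data.Nat.Base using (ℕ; zero; suc)
open import Data.Fin.Base using (Fin; splitAt; _↑ˡ_; _↑ʳ_)
open import Data.Fin.Properties using (_≟_)
open import Data.Sum.Base using (_⊎_; inj₁; inj₂)
open import Data.Product.Base using (Σ; _×_)
open import Relation.Nullary using (¬_; yes; no)
import Algebra.Definitions.RawSemiring as RS

module RingNotions {c ℓ} (R : CommutativeRing c ℓ) where
  open CommutativeRing R renaming (Carrier to A)
  open RS (Semiring.rawSemiring semiring) using () renaming (_×_ to _·ℕ_)

  IsUnit : A → Set (c ⊔ ℓ)
  IsUnit u = Σ A λ v → u * v ≈ 1#

  IsIntegralDomain : Set (c ⊔ ℓ)
  IsIntegralDomain = (¬ (1# ≈ 0#)) × (∀ x y → x * y ≈ 0# → (x ≈ 0#) ⊎ (y ≈ 0#))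

  CharZero : Set ℓ
  CharZero = ∀ n → ¬ ((suc n ·ℕ 1#) ≈ 0#)

  nat : ℕ → A
  nat m = m ·ℕ 1#

-- The symplectic module H_A = A^(2g) with symplectic basis a_i = e_i,
-- b_i = e_(g+i) (i : Fin g), its exterior powers Λ² H_A, Λ³ H_A modelled as
-- alternating 2- and 3-tensors, the GSp(H_A)-actions, and the two splittings.
module Setup {c ℓ} (R : CommutativeRing c ℓ) (g : ℕ) where
  open CommutativeRing R renaming (Carrier to A)
  open RS (Semiring.rawSemiring semiring) using (sum)
  open import Data.Nat.Base using () renaming (_+_ to _+ℕ_)

  rk : ℕ
  rk = g +ℕ g

  Idx : Set
  Idx = Fin rk

  H : Set c
  H = Idx → A

  T2 : Set c
  T2 = Idx → Idx → A

  T3 : Set c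
  T3 = Idx → Idx → Idx → A

  -- Λ² H_A = alternating 2-tensors (e_i ∧ e_j ↦ e_i⊗e_j − e_j⊗e_i)
  IsAlt2 : T2 → Set ℓ
  IsAlt2 t = (∀ i → t i i ≈ 0#) × (∀ i j → t i j ≈ - t j i)

  -- Λ³ H_A = alternating 3-tensors (e_i ∧ e_j ∧ e_k ↦ Σ_σ sgn σ e_σ(i)⊗e_σ(j)⊗e_σ(k))
  IsAlt3 : T3 → Set ℓ
  IsAlt3 t = ((∀ i k → t i i k ≈ 0#) × (∀ i k → t i k k ≈ 0#))
           × ((∀ i j k → t i j k ≈ - t j i k) × (∀ i j k → t i j k ≈ - t i k j))

  a b : Fin g → Idx
  a i = i ↑ˡ g
  b i = g ↑ʳ i

  β : H → H → A
  β x y = sum (λ i → (x (a i) * y (b i)) - (x (b i) * y (a i)))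

  Mat : Set c
  Mat = Idx → Idx → A

  act1 : Mat → H → H
  act1 φ x i = sum (λ k → φ i k * x k)

  act2 : Mat → T2 → T2
  act2 φ t i j = sum (λ k → sum (λ l → (φ i k * φ j l) * t k l))

  act3 : Mat → T3 → T3
  act3 φ t i j k = sum (λ p → sum (λ q → sum (λ r → ((φ i p * φ j q) * φ k r) * t p q r)))

  InGSp : Mat → A → Set (c ⊔ ℓ)
  InGSp φ τ = (Σ Mat λ ψ → (∀ x i → act1 ψ (act1 φ x) i ≈ x i)
                         × (∀ x i → act1 φ (act1 ψ x) i ≈ x i))
            × (∀ x y → β (act1 φ x) (act1 φ y) ≈ τ * β x y)

  -- θ̌(1) = Σ_i a_i ∧ b_i, as an alternating 2-tensor
  θ : T2
  θ i j with splitAt g i | splitAt g j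
  ... | inj₁ p | inj₂ q with p ≟ q
  ...   | yes _ = 1#
  ...   | no _  = 0#
  θ i j | inj₂ p | inj₁ q with p ≟ q
  ...   | yes _ = - 1#
  ...   | no _  = 0#
  θ i j | inj₁ _ | inj₁ _ = 0#
  θ i j | inj₂ _ | inj₂ _ = 0#

  θ∧ : H → T3
  θ∧ x i j k = ((θ i j * x k) + (θ j k * x i)) + (θ k i * x j)

  Linear2 : (T2 → A) → Set (c ⊔ ℓ)
  Linear2 r = (∀ s t → IsAlt2 s → IsAlt2 t → (∀ i j → s i j ≈ t i j) → r s ≈ r t)
            × ((∀ s t → IsAlt2 s → IsAlt2 t → r (λ i j → s i j + t i j) ≈ r s + r t)
            × (∀ u t → IsAlt2 t → r (λ i j → u * t i j) ≈ u * r t))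

  Linear3 : (T3 → H) → Set (c ⊔ ℓ)
  Linear3 r = (∀ s t → IsAlt3 s → IsAlt3 t → (∀ i j k → s i j k ≈ t i j k) → ∀ m → r s m ≈ r t m)
            × ((∀ s t → IsAlt3 s → IsAlt3 t → ∀ m → r (λ i j k → s i j k + t i j k) m ≈ r s m + r t m)
            × (∀ u t → IsAlt3 t → ∀ m → r (λ i j k → u * t i j k) m ≈ u * r t m))

  -- The sequence 0 → A(1) → Λ²H_A → Λ²₀H_A → 0 splits: θ̌ has a
  -- GSp(H_A)-equivariant A-linear retraction r : Λ²H_A → A(1).
  Splits2 : Set (c ⊔ ℓ)
  Splits2 = Σ (T2 → A) λ r → Linear2 r × ((r θ ≈ 1#)
          × (∀ φ τ τ' → τ * τ' ≈ 1# → InGSp φ τ →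
               ∀ t → IsAlt2 t → r (act2 φ t) ≈ τ * r t))

  -- The sequence 0 → H_A → (Λ³H_A)(-1) → Λ³₀H_A → 0 splits: θ̌∧ has a
  -- GSp(H_A)-equivariant A-linear retraction r : (Λ³H_A)(-1) → H_A.
  -- On (Λ³H_A)(-1), φ acts by τ(φ)⁻¹ Λ³φ.
  Splits3 : Set (c ⊔ ℓ)
  Splits3 = Σ (T3 → H) λ r → Linear3 r × ((∀ x m → r (θ∧ x) m ≈ x m)
          × (∀ φ τ τ' → τ * τ' ≈ 1# → InGSp φ τ →
               ∀ t → IsAlt3 t → ∀ m →
                 r (λ i j k → τ' * act3 φ t i j k) m ≈ act1 φ (r t) m))

module Submission where

-- Let E i = a_i ∧ b_i, so θ̌ = Σ_i E i, and let c(t) = Σ_i t(a_i, b_i).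
-- Key invariance (contraction-act2): if φ*β = τβ then c(Λ²φ t) = τ c(t) on
-- Λ²H.  Indeed c(Λ²φ t) = ⟨M, t⟩ with M = Σ_i φ(a_i) ⊗ φ(b_i), and
-- 2⟨M, t⟩ = ⟨M - Mᵀ, t⟩ = τ⟨matrix of β, t⟩ = 2τ c(t); 2 cancels since A is
-- a domain of characteristic 0.
-- Sufficiency: if g v = 1 then v c retracts θ̌; if (g - 1) v = 1 then
-- t ↦ v c(t(-,-,m)) retracts θ̌∧, because c(θ̌ ∧ x) = (g - 1) x.
-- Necessity: permutations of the planes ⟨a_i, b_i⟩ lie in GSp(H) with
-- multiplier 1, so an invariant additive ρ on Λ²H is constant on the E i.
-- For Λ², 1 = r(θ̌) = Σ_i r(E i) = g r(E 0).  For Λ³, ρ(F) = r(F ∧ a₀)(a₀) is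
-- invariant under permutations fixing plane 0, ρ(θ̌) = 1 and ρ(E 0) = 0
-- (a₀ ∧ b₀ ∧ a₀ = 0), so 1 = (g - 1) ρ(E 1).

open import Algebra.Bundles using (CommutativeRing)
open import Data.Nat.Base using (ℕ; zero; suc) renaming (_+_ to _+ℕ_)
open import Data.Fin.Base using (Fin; zero; suc; splitAt; _↑ˡ_; _↑ʳ_)
open import Data.Fin.Properties using (splitAt-↑ˡ; splitAt-↑ʳ; splitAt⁻¹-↑ˡ; splitAt⁻¹-↑ʳ)
  renaming (_≟_ to _≟ᶠ_)
import Data.Fin.Permutation.Components as PC
open import Data.Fin.Permutation using (Permutation; _⟨$⟩ʳ_; _⟨$⟩ˡ_; inverseˡ; inverseʳ; transpose)
open import Data.Sum.Base using (inj₁; inj₂; [_,_]′)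
open import Data.Product.Base using (_×_; _,_; proj₁; proj₂)
open import Data.Empty using (⊥-elim)
open import Level using (_⊔_)
open import Function.Base using (_∘_)
open import Function.Bundles using (_⇔_; mk⇔)
open import Relation.Nullary using (¬_; yes; no)
open import Relation.Nullary.Decidable using (dec-true)
import Relation.Binary.PropositionalEquality as ≡
open ≡ using (_≡_; _≢_)
import Algebra.Properties.Ring as RingProperties
import Algebra.Properties.Semiring.Sum as SumProperties
import Algebra.Properties.Semiring.Mult as MultProperties
import Algebra.Properties.CommutativeSemigroup as CommutativeSemigroupProperties
open import Defs

module RingLemmas {c ℓ} (R : CommutativeRing c ℓ) where
  open CommutativeRing R renaming (Carrier to A) hiding (zero)
  open RingNotions R using (IsIntegralDomain; CharZero; nat)
  open RingProperties ring public
    using (-0#≈0#; -‿involutive; -‿+-comm; -‿distribˡ-*; -‿distribʳ-*; ⁻¹-anti-homo‿-;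
           [y-z]x≈yx-zx; x∙y⁻¹≈ε⇒x≈y; x+x≈x⇒x≈0; xyx⁻¹≈y; -1*x≈-x)
  open SumProperties semiring public
    using (sum; sum-cong-≋; ∑-distrib-+; ∑-comm; sum-permute; *-distribˡ-sum; *-distribʳ-sum)
  open SumProperties semiring using (sum-replicate)
  open MultProperties semiring using (×-assoc-*; ×-congʳ)
  module +-CS = CommutativeSemigroupProperties +-commutativeSemigroup
  module *-CS = CommutativeSemigroupProperties *-commutativeSemigroup
  open import Relation.Binary.Reasoning.Setoid setoid

  x-0≈x : ∀ x → x - 0# ≈ x
  x-0≈x x = trans (+-congˡ -0#≈0#) (+-identityʳ x)

  sum-zero : ∀ {n} {f : Fin n → A} → (∀ i → f i ≈ 0#) → sum f ≈ 0#
  sum-zero {zero}  _  = refl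
  sum-zero {suc n} eq = trans (+-cong (eq zero) (sum-zero (eq ∘ suc))) (+-identityʳ 0#)

  sum-neg : ∀ {n} (f : Fin n → A) → sum (λ i → - f i) ≈ - sum f
  sum-neg {zero}  f = sym -0#≈0#
  sum-neg {suc n} f = trans (+-congˡ (sum-neg (f ∘ suc))) (-‿+-comm (f zero) (sum (f ∘ suc)))

  sum-- : ∀ {n} (f h : Fin n → A) → sum (λ i → f i - h i) ≈ sum f - sum h
  sum-- f h = trans (∑-distrib-+ f (λ i → - h i)) (+-congˡ (sum-neg h))

  sum-const : ∀ n (u : A) → sum {n} (λ _ → u) ≈ nat n * u
  sum-const n u = trans (sum-replicate n) (sym (trans (×-assoc-* n 1# u) (×-congʳ n (*-identityˡ u))))

  ∑-comm₃ : ∀ {l m n} (F : Fin l → Fin m → Fin n → A) →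
            sum (λ p → sum (λ q → sum (λ i → F p q i))) ≈ sum (λ i → sum (λ p → sum (λ q → F p q i)))
  ∑-comm₃ F = trans (sum-cong-≋ (λ p → ∑-comm (F p))) (∑-comm (λ p i → sum (λ q → F p q i)))

  sum-++ : ∀ m {n} (f : Fin (m +ℕ n) → A) → sum f ≈ sum (λ i → f (i ↑ˡ n)) + sum (λ i → f (m ↑ʳ i))
  sum-++ zero    f = sym (+-identityˡ _)
  sum-++ (suc m) f = trans (+-congˡ (sum-++ m (f ∘ suc))) (sym (+-assoc (f zero) _ _))

  δ : ∀ {n} → Fin n → Fin n → A
  δ zero    zero    = 1#
  δ zero    (suc _) = 0#
  δ (suc _) zero    = 0#
  δ (suc k) (suc m) = δ k m

  δ-diag : ∀ {n} (k : Fin n) → δ k k ≡ 1#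
  δ-diag zero    = ≡.refl
  δ-diag (suc k) = δ-diag k

  δ-off : ∀ {n} (k m : Fin n) → k ≢ m → δ k m ≡ 0#
  δ-off zero    zero    k≢m = ⊥-elim (k≢m ≡.refl)
  δ-off zero    (suc m) _   = ≡.refl
  δ-off (suc k) zero    _   = ≡.refl
  δ-off (suc k) (suc m) k≢m = δ-off k m (k≢m ∘ ≡.cong suc)

  δ-sym : ∀ {n} (k m : Fin n) → δ k m ≡ δ m k
  δ-sym zero    zero    = ≡.refl
  δ-sym zero    (suc m) = ≡.refl
  δ-sym (suc k) zero    = ≡.refl
  δ-sym (suc k) (suc m) = δ-sym k m

  δ-↑ˡ : ∀ {m n} (i p : Fin m) → δ (i ↑ˡ n) (p ↑ˡ n) ≡ δ i p
  δ-↑ˡ zero    zero    = ≡.refl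
  δ-↑ˡ zero    (suc p) = ≡.refl
  δ-↑ˡ (suc i) zero    = ≡.refl
  δ-↑ˡ (suc i) (suc p) = δ-↑ˡ i p

  δ-↑ʳ : ∀ m {n} (i p : Fin n) → δ (m ↑ʳ i) (m ↑ʳ p) ≡ δ i p
  δ-↑ʳ zero    i p = ≡.refl
  δ-↑ʳ (suc m) i p = δ-↑ʳ m i p

  δ-↑ˡ↑ʳ : ∀ {m n} (i : Fin m) (p : Fin n) → δ (i ↑ˡ n) (m ↑ʳ p) ≡ 0#
  δ-↑ˡ↑ʳ zero    p = ≡.refl
  δ-↑ˡ↑ʳ (suc i) p = δ-↑ˡ↑ʳ i p

  sum-δ : ∀ {n} (k : Fin n) (f : Fin n → A) → sum (λ m → δ k m * f m) ≈ f k
  sum-δ zero    f = trans (+-cong (*-identityˡ _) (sum-zero (λ m → zeroˡ (f (suc m))))) (+-identityʳ _)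
  sum-δ (suc k) f = trans (+-cong (zeroˡ _) (sum-δ k (f ∘ suc))) (+-identityˡ _)

  sum-δʳ : ∀ {n} (k : Fin n) (f : Fin n → A) → sum (λ m → f m * δ k m) ≈ f k
  sum-δʳ k f = trans (sum-cong-≋ (λ m → *-comm (f m) (δ k m))) (sum-δ k f)

  δ-bijection : ∀ {n} (f f′ : Fin n → Fin n) → (∀ x → f (f′ x) ≡ x) → (∀ k → f′ (f k) ≡ k) →
                ∀ k x → δ (f k) x ≡ δ k (f′ x)
  δ-bijection f f′ ff′ f′f k x with k ≟ᶠ f′ x
  ... | yes ≡.refl = ≡.trans (≡.cong (δ (f (f′ x))) (≡.sym (ff′ x)))
                             (≡.trans (δ-diag (f (f′ x))) (≡.sym (δ-diag (f′ x))))
  ... | no k≢f′x   = ≡.trans (δ-off (f k) x (λ fk≡x → k≢f′x (≡.trans (≡.sym (f′f k)) (≡.cong f′ fk≡x))))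
                             (≡.sym (δ-off k (f′ x) k≢f′x))

  double-injective : IsIntegralDomain → CharZero → ∀ x y → x + x ≈ y + y → x ≈ y
  double-injective (_ , noZeroDivisors) char0 x y 2x≈2y
    with noZeroDivisors (x - y) (1# + (1# + 0#)) twice[x-y]≈0
    where
    twice[x-y]≈0 : (x - y) * (1# + (1# + 0#)) ≈ 0#
    twice[x-y]≈0 = begin
      (x - y) * (1# + (1# + 0#))    ≈⟨ *-congˡ (+-congˡ (+-identityʳ 1#)) ⟩
      (x - y) * (1# + 1#)           ≈⟨ distribˡ (x - y) 1# 1# ⟩
      (x - y) * 1# + (x - y) * 1#   ≈⟨ +-cong (*-identityʳ _) (*-identityʳ _) ⟩
      (x - y) + (x - y)             ≈⟨ +-CS.interchange x (- y) x (- y) ⟩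
      (x + x) + (- y + - y)         ≈⟨ +-cong 2x≈2y (-‿+-comm y y) ⟩
      (y + y) - (y + y)             ≈⟨ -‿inverseʳ (y + y) ⟩
      0#                            ∎
  ... | inj₁ x-y≈0 = x∙y⁻¹≈ε⇒x≈y x y x-y≈0
  ... | inj₂ 2≈0   = ⊥-elim (char0 1 2≈0)

  transpose-moves : ∀ {n} (i j : Fin n) → PC.transpose i j i ≡ j
  transpose-moves i j rewrite dec-true (i ≟ᶠ i) ≡.refl = ≡.refl

module Symplectic {c ℓ} (R : CommutativeRing c ℓ) (g : ℕ) where
  open CommutativeRing R renaming (Carrier to A) hiding (zero)
  open RingNotions R using (IsIntegralDomain; CharZero; nat)
  open RingLemmas R
  open Setup R g
  open import Relation.Binary.Reasoning.Setoid setoid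

  data SymplecticIndex : Idx → Set where
    is-a : ∀ p → SymplecticIndex (a p)
    is-b : ∀ p → SymplecticIndex (b p)

  symplecticIndex : ∀ k → SymplecticIndex k
  symplecticIndex k with splitAt g k in eq
  ... | inj₁ p = ≡.subst SymplecticIndex (splitAt⁻¹-↑ˡ eq) (is-a p)
  ... | inj₂ p = ≡.subst SymplecticIndex (splitAt⁻¹-↑ʳ eq) (is-b p)

  sum-ab : (f : Idx → A) → sum f ≈ sum (λ i → f (a i)) + sum (λ i → f (b i))
  sum-ab = sum-++ g

  δ-aa : ∀ p q → δ (a p) (a q) ≡ δ p q
  δ-aa = δ-↑ˡ

  δ-bb : ∀ p q → δ (b p) (b q) ≡ δ p q
  δ-bb = δ-↑ʳ g

  δ-ab : ∀ p q → δ (a p) (b q) ≡ 0#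
  δ-ab = δ-↑ˡ↑ʳ

  δ-ba : ∀ p q → δ (b p) (a q) ≡ 0#
  δ-ba p q = ≡.trans (δ-sym (b p) (a q)) (δ-ab q p)

  ω : Fin g → H → H → A
  ω i x y = x (a i) * y (b i) - x (b i) * y (a i)

  ω-diag : ∀ i x → ω i x x ≈ 0#
  ω-diag i x = trans (+-congʳ (*-comm (x (a i)) (x (b i)))) (-‿inverseʳ _)

  ω-antisym : ∀ i x y → ω i x y ≈ - ω i y x
  ω-antisym i x y = sym (trans (⁻¹-anti-homo‿- _ _) (+-cong (*-comm _ _) (-‿cong (*-comm _ _))))

  β-diag : ∀ x → β x x ≈ 0#
  β-diag x = sum-zero (λ i → ω-diag i x)

  β-antisym : ∀ x y → β x y ≈ - β y x
  β-antisym x y = trans (sum-cong-≋ (λ i → ω-antisym i x y)) (sum-neg (λ i → ω i y x))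

  β-cong : ∀ {x x′ y y′ : H} → (∀ k → x k ≈ x′ k) → (∀ k → y k ≈ y′ k) → β x y ≈ β x′ y′
  β-cong x≈ y≈ = sum-cong-≋ (λ i → +-cong (*-cong (x≈ (a i)) (y≈ (b i))) (-‿cong (*-cong (x≈ (b i)) (y≈ (a i)))))

  β-a : ∀ p y → β (δ (a p)) y ≈ y (b p)
  β-a p y = trans (sum-cong-≋ term) (sum-δ p (λ i → y (b i)))
    where
    term : ∀ i → ω i (δ (a p)) y ≈ δ p i * y (b i)
    term i = begin
      δ (a p) (a i) * y (b i) - δ (a p) (b i) * y (a i)
        ≈⟨ +-cong (*-congʳ (reflexive (δ-aa p i))) (-‿cong (trans (*-congʳ (reflexive (δ-ab p i))) (zeroˡ _))) ⟩
      δ p i * y (b i) - 0#  ≈⟨ x-0≈x _ ⟩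
      δ p i * y (b i)       ∎

  β-b : ∀ p y → β (δ (b p)) y ≈ - y (a p)
  β-b p y = trans (sum-cong-≋ term) (trans (sum-neg (λ i → δ p i * y (a i))) (-‿cong (sum-δ p (λ i → y (a i)))))
    where
    term : ∀ i → ω i (δ (b p)) y ≈ - (δ p i * y (a i))
    term i = begin
      δ (b p) (a i) * y (b i) - δ (b p) (b i) * y (a i)
        ≈⟨ +-cong (trans (*-congʳ (reflexive (δ-ba p i))) (zeroˡ _)) (-‿cong (*-congʳ (reflexive (δ-bb p i)))) ⟩
      0# - δ p i * y (a i)  ≈⟨ +-identityˡ _ ⟩
      - (δ p i * y (a i))   ∎

  θ-aa : ∀ p q → θ (a p) (a q) ≈ 0#
  θ-aa p q rewrite splitAt-↑ˡ g p g | splitAt-↑ˡ g q g = refl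

  θ-bb : ∀ p q → θ (b p) (b q) ≈ 0#
  θ-bb p q rewrite splitAt-↑ʳ g g p | splitAt-↑ʳ g g q = refl

  θ-ab : ∀ p q → θ (a p) (b q) ≈ δ p q
  θ-ab p q rewrite splitAt-↑ˡ g p g | splitAt-↑ʳ g g q with p ≟ᶠ q
  ... | yes ≡.refl = reflexive (≡.sym (δ-diag p))
  ... | no p≢q     = reflexive (≡.sym (δ-off p q p≢q))

  θ-ba : ∀ p q → θ (b p) (a q) ≈ - δ p q
  θ-ba p q rewrite splitAt-↑ˡ g q g | splitAt-↑ʳ g g p with p ≟ᶠ q
  ... | yes ≡.refl = -‿cong (reflexive (≡.sym (δ-diag p)))
  ... | no p≢q     = trans (sym -0#≈0#) (-‿cong (reflexive (≡.sym (δ-off p q p≢q))))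

  θ-matrix : ∀ k l → θ k l ≈ β (δ k) (δ l)
  θ-matrix k l with symplecticIndex k | symplecticIndex l
  ... | is-a p | is-a q = trans (θ-aa p q) (sym (trans (β-a p (δ (a q))) (reflexive (δ-ab q p))))
  ... | is-a p | is-b q = trans (θ-ab p q) (sym (trans (β-a p (δ (b q))) (reflexive (≡.trans (δ-bb q p) (δ-sym q p)))))
  ... | is-b p | is-a q = trans (θ-ba p q) (sym (trans (β-b p (δ (a q))) (-‿cong (reflexive (≡.trans (δ-aa q p) (δ-sym q p))))))
  ... | is-b p | is-b q = trans (θ-bb p q) (sym (trans (β-b p (δ (b q))) (trans (-‿cong (reflexive (δ-ba q p))) -0#≈0#)))

  θ-alt : IsAlt2 θ
  θ-alt = (λ k → trans (θ-matrix k k) (β-diag (δ k)))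
        , (λ k l → trans (θ-matrix k l) (trans (β-antisym (δ k) (δ l)) (-‿cong (sym (θ-matrix l k)))))

  -- E i = a_i ∧ b_i, the matrix of ω i; θ̌ = Σ_i E i by θ-matrix.
  E : Fin g → T2
  E i k l = ω i (δ k) (δ l)

  E-alt : ∀ i → IsAlt2 (E i)
  E-alt i = (λ k → ω-diag i (δ k)) , (λ k l → ω-antisym i (δ k) (δ l))

  alt2-cong : ∀ {s t : T2} → IsAlt2 s → (∀ k l → t k l ≈ s k l) → IsAlt2 t
  alt2-cong (diag , anti) t≈s = (λ k → trans (t≈s k k) (diag k))
                              , (λ k l → trans (t≈s k l) (trans (anti k l) (-‿cong (sym (t≈s l k)))))

  alt3-cong : ∀ {s t : T3} → IsAlt3 s → (∀ k l m → t k l m ≈ s k l m) → IsAlt3 t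
  alt3-cong ((diag₁ , diag₂) , (anti₁ , anti₂)) t≈s =
      ((λ k m → trans (t≈s k k m) (diag₁ k m)) , (λ k m → trans (t≈s k m m) (diag₂ k m)))
    , ((λ k l m → trans (t≈s k l m) (trans (anti₁ k l m) (-‿cong (sym (t≈s l k m)))))
     , (λ k l m → trans (t≈s k l m) (trans (anti₂ k l m) (-‿cong (sym (t≈s k m l))))))

  alt2-zero : IsAlt2 (λ _ _ → 0#)
  alt2-zero = (λ _ → refl) , (λ _ _ → sym -0#≈0#)

  alt2-+ : ∀ {s t : T2} → IsAlt2 s → IsAlt2 t → IsAlt2 (λ k l → s k l + t k l)
  alt2-+ (diagₛ , antiₛ) (diagₜ , antiₜ) =
      (λ k → trans (+-cong (diagₛ k) (diagₜ k)) (+-identityʳ 0#))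
    , (λ k l → trans (+-cong (antiₛ k l) (antiₜ k l)) (-‿+-comm _ _))

  alt2-sum : ∀ {n} (F : Fin n → T2) → (∀ i → IsAlt2 (F i)) → IsAlt2 (λ k l → sum (λ i → F i k l))
  alt2-sum {zero}  F alt = alt2-zero
  alt2-sum {suc n} F alt = alt2-+ (alt zero) (alt2-sum (F ∘ suc) (alt ∘ suc))

  contraction : T2 → A
  contraction t = sum (λ i → t (a i) (b i))

  contraction-θ : contraction θ ≈ nat g
  contraction-θ = trans (sum-cong-≋ (λ i → trans (θ-ab i i) (reflexive (δ-diag i))))
                        (trans (sum-const g 1#) (*-identityʳ (nat g)))

  contraction-scale : ∀ u t → contraction (λ p q → u * t p q) ≈ u * contraction t
  contraction-scale u t = sym (*-distribˡ-sum u (λ i → t (a i) (b i)))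

  -- The pairing ⟨M, t⟩ = Σ_{k,l} M_kl t_kl; note (act2 φ t) p q ≡ ⟨φ_p ⊗ φ_q, t⟩.
  pairing : T2 → T2 → A
  pairing M t = sum (λ k → sum (λ l → M k l * t k l))

  pairing-cong : ∀ {M N} t → (∀ k l → M k l ≈ N k l) → pairing M t ≈ pairing N t
  pairing-cong t M≈N = sum-cong-≋ (λ k → sum-cong-≋ (λ l → *-congʳ (M≈N k l)))

  pairing-- : ∀ M N t → pairing (λ k l → M k l - N k l) t ≈ pairing M t - pairing N t
  pairing-- M N t =
    trans (sum-cong-≋ (λ k → trans (sum-cong-≋ (λ l → [y-z]x≈yx-zx (t k l) (M k l) (N k l)))
                                   (sum-- (λ l → M k l * t k l) (λ l → N k l * t k l))))
          (sum-- (λ k → sum (λ l → M k l * t k l)) (λ k → sum (λ l → N k l * t k l)))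

  pairing-scale : ∀ u M t → pairing (λ k l → u * M k l) t ≈ u * pairing M t
  pairing-scale u M t =
    trans (sum-cong-≋ (λ k → trans (sum-cong-≋ (λ l → *-assoc u (M k l) (t k l)))
                                   (sym (*-distribˡ-sum u (λ l → M k l * t k l)))))
          (sym (*-distribˡ-sum u (λ k → sum (λ l → M k l * t k l))))

  pairing-sum : ∀ {n} (F : Fin n → T2) t → pairing (λ k l → sum (λ i → F i k l)) t ≈ sum (λ i → pairing (F i) t)
  pairing-sum F t = trans (sum-cong-≋ (λ k → sum-cong-≋ (λ l → *-distribʳ-sum (t k l) (λ i → F i k l))))
                          (∑-comm₃ (λ k l i → F i k l * t k l))

  pairing-δδ : ∀ x y t → pairing (λ k l → δ x k * δ y l) t ≈ t x y
  pairing-δδ x y t = begin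
    sum (λ k → sum (λ l → (δ x k * δ y l) * t k l))
      ≈⟨ sum-cong-≋ (λ k → trans (sum-cong-≋ (λ l → *-assoc (δ x k) (δ y l) (t k l)))
                                 (sym (*-distribˡ-sum (δ x k) (λ l → δ y l * t k l)))) ⟩
    sum (λ k → δ x k * sum (λ l → δ y l * t k l))  ≈⟨ sum-cong-≋ (λ k → *-congˡ (sum-δ y (t k))) ⟩
    sum (λ k → δ x k * t k y)                       ≈⟨ sum-δ x (λ k → t k y) ⟩
    t x y                                           ∎

  pairing-transpose : ∀ M t → (∀ k l → t k l ≈ - t l k) → pairing (λ k l → M l k) t ≈ - pairing M t
  pairing-transpose M t anti =
    trans (∑-comm (λ k l → M l k * t k l))
          (trans (sum-cong-≋ (λ k → trans (sum-cong-≋ (λ l → trans (*-congˡ (anti l k))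
                                                                 (sym (-‿distribʳ-* (M k l) (t k l)))))
                                          (sum-neg (λ l → M k l * t k l))))
                 (sum-neg (λ k → sum (λ l → M k l * t k l))))

  pairing-E : ∀ i t → pairing (E i) t ≈ t (a i) (b i) - t (b i) (a i)
  pairing-E i t = begin
    pairing (E i) t
      ≈⟨ pairing-cong t (λ k l → reflexive (≡.cong₂ _-_ (≡.cong₂ _*_ (δ-sym k (a i)) (δ-sym l (b i)))
                                                       (≡.cong₂ _*_ (δ-sym k (b i)) (δ-sym l (a i))))) ⟩
    pairing (λ k l → δ (a i) k * δ (b i) l - δ (b i) k * δ (a i) l) t
      ≈⟨ pairing-- _ _ t ⟩
    pairing (λ k l → δ (a i) k * δ (b i) l) t - pairing (λ k l → δ (b i) k * δ (a i) l) t
      ≈⟨ +-cong (pairing-δδ (a i) (b i) t) (-‿cong (pairing-δδ (b i) (a i) t)) ⟩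
    t (a i) (b i) - t (b i) (a i) ∎

  pairing-β : ∀ t → (∀ k l → t k l ≈ - t l k) → pairing (λ k l → β (δ k) (δ l)) t ≈ contraction t + contraction t
  pairing-β t anti = begin
    pairing (λ k l → sum (λ i → E i k l)) t         ≈⟨ pairing-sum E t ⟩
    sum (λ i → pairing (E i) t)
      ≈⟨ sum-cong-≋ (λ i → trans (pairing-E i t) (+-congˡ (-‿cong (anti (b i) (a i))))) ⟩
    sum (λ i → t (a i) (b i) - - t (a i) (b i))     ≈⟨ sum-cong-≋ (λ i → +-congˡ (-‿involutive (t (a i) (b i)))) ⟩
    sum (λ i → t (a i) (b i) + t (a i) (b i))       ≈⟨ ∑-distrib-+ (λ i → t (a i) (b i)) (λ i → t (a i) (b i)) ⟩
    contraction t + contraction t                   ∎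

  act1-δ : ∀ φ k j → act1 φ (δ k) j ≈ φ j k
  act1-δ φ k j = sum-δʳ k (φ j)

  contraction-act2 : IsIntegralDomain → CharZero → ∀ φ τ →
                     (∀ x y → β (act1 φ x) (act1 φ y) ≈ τ * β x y) →
                     ∀ t → (∀ k l → t k l ≈ - t l k) → contraction (act2 φ t) ≈ τ * contraction t
  contraction-act2 dom char0 φ τ φ*β≈τβ t anti =
    trans (sym (pairing-sum N t)) (double-injective dom char0 _ _ (begin
      X + X
        ≈⟨ +-congˡ (sym (trans (-‿cong (pairing-transpose M t anti)) (-‿involutive X))) ⟩
      X - pairing (λ k l → M l k) t                  ≈⟨ sym (pairing-- M (λ k l → M l k) t) ⟩
      pairing (λ k l → M k l - M l k) t              ≈⟨ pairing-cong t antisymmetrised-M ⟩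
      pairing (λ k l → τ * β (δ k) (δ l)) t          ≈⟨ pairing-scale τ _ t ⟩
      τ * pairing (λ k l → β (δ k) (δ l)) t          ≈⟨ *-congˡ (pairing-β t anti) ⟩
      τ * (contraction t + contraction t)            ≈⟨ distribˡ τ _ _ ⟩
      τ * contraction t + τ * contraction t          ∎))
    where
    N : Fin g → T2
    N i k l = φ (a i) k * φ (b i) l
    M : T2
    M k l = sum (λ i → N i k l)
    X : A
    X = pairing M t
    column : Idx → H
    column k j = φ j k
    antisymmetrised-M : ∀ k l → M k l - M l k ≈ τ * β (δ k) (δ l)
    antisymmetrised-M k l = begin
      M k l - M l k                         ≈⟨ sym (sum-- (λ i → N i k l) (λ i → N i l k)) ⟩
      sum (λ i → N i k l - N i l k)         ≈⟨ sum-cong-≋ (λ i → +-congˡ (-‿cong (*-comm (φ (a i) l) (φ (b i) k)))) ⟩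
      β (column k) (column l)               ≈⟨ sym (β-cong (act1-δ φ k) (act1-δ φ l)) ⟩
      β (act1 φ (δ k)) (act1 φ (δ l))       ≈⟨ φ*β≈τβ (δ k) (δ l) ⟩
      τ * β (δ k) (δ l)                     ∎

  act3-slice : ∀ φ t p q m → act3 φ t p q m ≈ sum (λ s → φ m s * act2 φ (λ x y → t x y s) p q)
  act3-slice φ t p q m = begin
    sum (λ x → sum (λ y → sum (λ s → ((φ p x * φ q y) * φ m s) * t x y s)))
      ≈⟨ sum-cong-≋ (λ x → sum-cong-≋ (λ y → sum-cong-≋ (λ s → *-CS.xy∙z≈y∙xz (φ p x * φ q y) (φ m s) (t x y s)))) ⟩
    sum (λ x → sum (λ y → sum (λ s → φ m s * ((φ p x * φ q y) * t x y s))))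
      ≈⟨ ∑-comm₃ (λ x y s → φ m s * ((φ p x * φ q y) * t x y s)) ⟩
    sum (λ s → sum (λ x → sum (λ y → φ m s * ((φ p x * φ q y) * t x y s))))
      ≈⟨ sum-cong-≋ (λ s → trans (sum-cong-≋ (λ x → sym (*-distribˡ-sum (φ m s) (λ y → (φ p x * φ q y) * t x y s))))
                                 (sym (*-distribˡ-sum (φ m s) (λ x → sum (λ y → (φ p x * φ q y) * t x y s))))) ⟩
    sum (λ s → φ m s * act2 φ (λ x y → t x y s) p q) ∎

  contraction-act3 : IsIntegralDomain → CharZero → ∀ φ τ →
                     (∀ x y → β (act1 φ x) (act1 φ y) ≈ τ * β x y) →
                     ∀ t → (∀ k l m → t k l m ≈ - t l k m) → ∀ m →
                     contraction (λ p q → act3 φ t p q m) ≈ sum (λ s → φ m s * (τ * contraction (λ p q → t p q s)))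
  contraction-act3 dom char0 φ τ φ*β≈τβ t anti m = begin
    contraction (λ p q → act3 φ t p q m)
      ≈⟨ sum-cong-≋ (λ i → act3-slice φ t (a i) (b i) m) ⟩
    contraction (λ p q → sum (λ s → φ m s * act2 φ (slice s) p q))
      ≈⟨ ∑-comm (λ i s → φ m s * act2 φ (slice s) (a i) (b i)) ⟩
    sum (λ s → contraction (λ p q → φ m s * act2 φ (slice s) p q))
      ≈⟨ sum-cong-≋ (λ s → contraction-scale (φ m s) (act2 φ (slice s))) ⟩
    sum (λ s → φ m s * contraction (act2 φ (slice s)))
      ≈⟨ sum-cong-≋ (λ s → *-congˡ (contraction-act2 dom char0 φ τ φ*β≈τβ (slice s) (λ k l → anti k l s))) ⟩
    sum (λ s → φ m s * (τ * contraction (slice s))) ∎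
    where
    slice : Idx → T2
    slice s x y = t x y s

module Sufficiency {c ℓ} (R : CommutativeRing c ℓ) (dom : RingNotions.IsIntegralDomain R)
                   (char0 : RingNotions.CharZero R) (g : ℕ) where
  open CommutativeRing R renaming (Carrier to A) hiding (zero)
  open RingNotions R using (IsUnit; nat)
  open RingLemmas R
  open Setup R g
  open Symplectic R g
  open import Relation.Binary.Reasoning.Setoid setoid

  scaled-contraction-linear : ∀ v → Linear2 (λ t → v * contraction t)
  scaled-contraction-linear v =
      (λ s t _ _ s≈t → *-congˡ (sum-cong-≋ (λ i → s≈t (a i) (b i))))
    , (λ s t _ _ → trans (*-congˡ (∑-distrib-+ (λ i → s (a i) (b i)) (λ i → t (a i) (b i)))) (distribˡ v _ _))
    , (λ u t _ → trans (*-congˡ (contraction-scale u t)) (*-CS.x∙yz≈y∙xz v u (contraction t)))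

  scaled-slice-contraction-linear : ∀ v → Linear3 (λ t m → v * contraction (λ p q → t p q m))
  scaled-slice-contraction-linear v =
      (λ s t _ _ s≈t m → *-congˡ (sum-cong-≋ (λ i → s≈t (a i) (b i) m)))
    , (λ s t _ _ m → trans (*-congˡ (∑-distrib-+ (λ i → s (a i) (b i) m) (λ i → t (a i) (b i) m))) (distribˡ v _ _))
    , (λ u t _ m → trans (*-congˡ (contraction-scale u (λ p q → t p q m))) (*-CS.x∙yz≈y∙xz v u _))

  unit⇒splits2 : IsUnit (nat g) → Splits2
  unit⇒splits2 (v , gv≈1) = r , scaled-contraction-linear v , retraction , equivariant
    where
    r : T2 → A
    r t = v * contraction t
    retraction : r θ ≈ 1#
    retraction = trans (*-congˡ contraction-θ) (trans (*-comm v (nat g)) gv≈1)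
    equivariant : ∀ φ τ τ′ → τ * τ′ ≈ 1# → InGSp φ τ → ∀ t → IsAlt2 t → r (act2 φ t) ≈ τ * r t
    equivariant φ τ _ _ (_ , φ*β≈τβ) t (_ , anti) =
      trans (*-congˡ (contraction-act2 dom char0 φ τ φ*β≈τβ t anti)) (*-CS.x∙yz≈y∙xz v τ (contraction t))

  -- The terms of c(θ̌ ∧ x) at slot m other than the g copies of x m add up to - x m.
  mixed-terms : ∀ (x : H) m → sum (λ i → θ (b i) m * x (a i)) + sum (λ i → θ m (a i) * x (b i)) ≈ - x m
  mixed-terms x m = begin
    sum (λ i → θ (b i) m * x (a i)) + sum (λ i → θ m (a i) * x (b i))
      ≈⟨ +-cong (sum-cong-≋ (λ i → trans (*-congʳ (θ-b-m i)) (sym (-‿distribˡ-* (δ m (a i)) (x (a i))))))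
                (sum-cong-≋ (λ i → trans (*-congʳ (θ-m-a i)) (sym (-‿distribˡ-* (δ m (b i)) (x (b i)))))) ⟩
    sum (λ i → - (δ m (a i) * x (a i))) + sum (λ i → - (δ m (b i) * x (b i)))
      ≈⟨ +-cong (sum-neg (λ i → δ m (a i) * x (a i))) (sum-neg (λ i → δ m (b i) * x (b i))) ⟩
    - sum (λ i → δ m (a i) * x (a i)) + - sum (λ i → δ m (b i) * x (b i))
      ≈⟨ -‿+-comm _ _ ⟩
    - (sum (λ i → δ m (a i) * x (a i)) + sum (λ i → δ m (b i) * x (b i)))
      ≈⟨ -‿cong (sym (sum-ab (λ k → δ m k * x k))) ⟩
    - sum (λ k → δ m k * x k)
      ≈⟨ -‿cong (sum-δ m x) ⟩
    - x m ∎
    where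
    θ-b-m : ∀ i → θ (b i) m ≈ - δ m (a i)
    θ-b-m i = trans (θ-matrix (b i) m) (β-b i (δ m))
    θ-m-a : ∀ i → θ m (a i) ≈ - δ m (b i)
    θ-m-a i = trans (θ-matrix m (a i)) (trans (β-antisym (δ m) (δ (a i))) (-‿cong (β-a i (δ m))))

  contraction-θ∧ : ∀ x m → contraction (λ p q → θ∧ x p q m) ≈ (nat g - 1#) * x m
  contraction-θ∧ x m = begin
    contraction (λ p q → θ∧ x p q m)
      ≈⟨ trans (∑-distrib-+ (λ i → θ (a i) (b i) * x m + θ (b i) m * x (a i)) (λ i → θ m (a i) * x (b i)))
               (+-congʳ (∑-distrib-+ (λ i → θ (a i) (b i) * x m) (λ i → θ (b i) m * x (a i)))) ⟩
    (sum (λ i → θ (a i) (b i) * x m) + sum (λ i → θ (b i) m * x (a i))) + sum (λ i → θ m (a i) * x (b i))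
      ≈⟨ +-assoc _ _ _ ⟩
    sum (λ i → θ (a i) (b i) * x m) + (sum (λ i → θ (b i) m * x (a i)) + sum (λ i → θ m (a i) * x (b i)))
      ≈⟨ +-cong (trans (sym (*-distribʳ-sum (x m) (λ i → θ (a i) (b i)))) (*-congʳ contraction-θ)) (mixed-terms x m) ⟩
    nat g * x m + - x m
      ≈⟨ +-congˡ (-‿cong (sym (*-identityˡ (x m)))) ⟩
    nat g * x m - 1# * x m
      ≈⟨ sym ([y-z]x≈yx-zx (x m) (nat g) 1#) ⟩
    (nat g - 1#) * x m ∎

  unit⇒splits3 : IsUnit (nat g - 1#) → Splits3
  unit⇒splits3 (v , [g-1]v≈1) = r , scaled-slice-contraction-linear v , retraction , equivariant
    where
    r : T3 → H
    r t m = v * contraction (λ p q → t p q m)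
    retraction : ∀ x m → r (θ∧ x) m ≈ x m
    retraction x m = begin
      v * contraction (λ p q → θ∧ x p q m)  ≈⟨ *-congˡ (contraction-θ∧ x m) ⟩
      v * ((nat g - 1#) * x m)              ≈⟨ sym (*-assoc v _ (x m)) ⟩
      (v * (nat g - 1#)) * x m              ≈⟨ *-congʳ (trans (*-comm v _) [g-1]v≈1) ⟩
      1# * x m                              ≈⟨ *-identityˡ (x m) ⟩
      x m                                   ∎
    cancel : ∀ τ τ′ → τ * τ′ ≈ 1# → ∀ y z → v * (τ′ * (y * (τ * z))) ≈ y * (v * z)
    cancel τ τ′ ττ′≈1 y z = begin
      v * (τ′ * (y * (τ * z)))  ≈⟨ *-congˡ (*-congˡ (*-CS.x∙yz≈y∙xz y τ z)) ⟩
      v * (τ′ * (τ * (y * z)))  ≈⟨ *-congˡ (sym (*-assoc τ′ τ (y * z))) ⟩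
      v * ((τ′ * τ) * (y * z))  ≈⟨ *-congˡ (*-congʳ (trans (*-comm τ′ τ) ττ′≈1)) ⟩
      v * (1# * (y * z))        ≈⟨ *-congˡ (*-identityˡ (y * z)) ⟩
      v * (y * z)               ≈⟨ *-CS.x∙yz≈y∙xz v y z ⟩
      y * (v * z)               ∎
    equivariant : ∀ φ τ τ′ → τ * τ′ ≈ 1# → InGSp φ τ → ∀ t → IsAlt3 t → ∀ m →
                  r (λ i j k → τ′ * act3 φ t i j k) m ≈ act1 φ (r t) m
    equivariant φ τ τ′ ττ′≈1 (_ , φ*β≈τβ) t (_ , (anti , _)) m = begin
      v * contraction (λ p q → τ′ * act3 φ t p q m)
        ≈⟨ *-congˡ (contraction-scale τ′ (λ p q → act3 φ t p q m)) ⟩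
      v * (τ′ * contraction (λ p q → act3 φ t p q m))
        ≈⟨ *-congˡ (*-congˡ (contraction-act3 dom char0 φ τ φ*β≈τβ t anti m)) ⟩
      v * (τ′ * sum (λ s → φ m s * (τ * κ s)))
        ≈⟨ *-congˡ (*-distribˡ-sum τ′ (λ s → φ m s * (τ * κ s))) ⟩
      v * sum (λ s → τ′ * (φ m s * (τ * κ s)))
        ≈⟨ *-distribˡ-sum v (λ s → τ′ * (φ m s * (τ * κ s))) ⟩
      sum (λ s → v * (τ′ * (φ m s * (τ * κ s))))
        ≈⟨ sum-cong-≋ (λ s → cancel τ τ′ ττ′≈1 (φ m s) (κ s)) ⟩
      sum (λ s → φ m s * (v * κ s)) ∎
      where
      κ : Idx → A
      κ s = contraction (λ p q → t p q s)

module Necessity {c ℓ} (R : CommutativeRing c ℓ) (g : ℕ) where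
  open CommutativeRing R renaming (Carrier to A) hiding (zero)
  open RingLemmas R
  open Setup R g
  open Symplectic R g
  open import Relation.Binary.Reasoning.Setoid setoid

  liftIdx : (Fin g → Fin g) → Idx → Idx
  liftIdx h k = [ a ∘ h , b ∘ h ]′ (splitAt g k)

  liftIdx-a : ∀ h p → liftIdx h (a p) ≡ a (h p)
  liftIdx-a h p rewrite splitAt-↑ˡ g p g = ≡.refl

  liftIdx-b : ∀ h p → liftIdx h (b p) ≡ b (h p)
  liftIdx-b h p rewrite splitAt-↑ʳ g g p = ≡.refl

  liftIdx-inverse : ∀ h h′ → (∀ p → h (h′ p) ≡ p) → ∀ k → liftIdx h (liftIdx h′ k) ≡ k
  liftIdx-inverse h h′ hh′ k with symplecticIndex k
  ... | is-a p = ≡.trans (≡.cong (liftIdx h) (liftIdx-a h′ p)) (≡.trans (liftIdx-a h (h′ p)) (≡.cong a (hh′ p)))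
  ... | is-b p = ≡.trans (≡.cong (liftIdx h) (liftIdx-b h′ p)) (≡.trans (liftIdx-b h (h′ p)) (≡.cong b (hh′ p)))

  reindex : (Idx → Idx) → Mat
  reindex π k l = δ (π k) l

  act1-reindex : ∀ π x k → act1 (reindex π) x k ≈ x (π k)
  act1-reindex π x k = sum-δ (π k) x

  act2-reindex : ∀ π t k l → act2 (reindex π) t k l ≈ t (π k) (π l)
  act2-reindex π t k l = pairing-δδ (π k) (π l) t

  act3-reindex : ∀ π t k l m → act3 (reindex π) t k l m ≈ t (π k) (π l) (π m)
  act3-reindex π t k l m = begin
    act3 (reindex π) t k l m
      ≈⟨ act3-slice (reindex π) t k l m ⟩
    sum (λ s → δ (π m) s * act2 (reindex π) (λ x y → t x y s) k l)
      ≈⟨ sum-cong-≋ (λ s → *-congˡ (act2-reindex π (λ x y → t x y s) k l)) ⟩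
    sum (λ s → δ (π m) s * t (π k) (π l) s)
      ≈⟨ sum-δ (π m) (t (π k) (π l)) ⟩
    t (π k) (π l) (π m) ∎

  alt2-reindex : ∀ (π : Idx → Idx) {t : T2} → IsAlt2 t → IsAlt2 (λ k l → t (π k) (π l))
  alt2-reindex π (diag , anti) = (λ k → diag (π k)) , (λ k l → anti (π k) (π l))

  module PlanePermutation (σ : Permutation g g) where
    π π⁻¹ : Idx → Idx
    π   = liftIdx (σ ⟨$⟩ʳ_)
    π⁻¹ = liftIdx (σ ⟨$⟩ˡ_)

    π∘π⁻¹ : ∀ k → π (π⁻¹ k) ≡ k
    π∘π⁻¹ = liftIdx-inverse _ _ (λ p → inverseʳ σ)

    π⁻¹∘π : ∀ k → π⁻¹ (π k) ≡ k
    π⁻¹∘π = liftIdx-inverse _ _ (λ p → inverseˡ σ)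

    δ-π : ∀ k x → δ (π k) x ≡ δ k (π⁻¹ x)
    δ-π = δ-bijection π π⁻¹ π∘π⁻¹ π⁻¹∘π

    preserves-β : ∀ x y → β (act1 (reindex π) x) (act1 (reindex π) y) ≈ 1# * β x y
    preserves-β x y = begin
      β (act1 (reindex π) x) (act1 (reindex π) y)  ≈⟨ β-cong (act1-reindex π x) (act1-reindex π y) ⟩
      β (x ∘ π) (y ∘ π)                            ≈⟨ sum-cong-≋ (λ i → reflexive (permuted-plane i)) ⟩
      sum (λ i → ω (σ ⟨$⟩ʳ i) x y)                 ≈⟨ sym (sum-permute (λ i → ω i x y) σ) ⟩
      β x y                                        ≈⟨ sym (*-identityˡ (β x y)) ⟩
      1# * β x y                                   ∎
      where
      permuted-plane : ∀ i → ω i (x ∘ π) (y ∘ π) ≡ ω (σ ⟨$⟩ʳ i) x y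
      permuted-plane i = ≡.cong₂ _-_
        (≡.cong₂ _*_ (≡.cong x (liftIdx-a _ i)) (≡.cong y (liftIdx-b _ i)))
        (≡.cong₂ _*_ (≡.cong x (liftIdx-b _ i)) (≡.cong y (liftIdx-a _ i)))

    in-GSp : InGSp (reindex π) 1#
    in-GSp = ( reindex π⁻¹
             , (λ x k → trans (act1-reindex π⁻¹ _ k)
                              (trans (act1-reindex π x (π⁻¹ k)) (reflexive (≡.cong x (π∘π⁻¹ k)))))
             , (λ x k → trans (act1-reindex π _ k)
                              (trans (act1-reindex π⁻¹ x (π k)) (reflexive (≡.cong x (π⁻¹∘π k))))) )
           , preserves-β

    E-reindex : ∀ i k l → E i (π k) (π l) ≡ E (σ ⟨$⟩ˡ i) k l
    E-reindex i k l = ≡.cong₂ _-_ (≡.cong₂ _*_ (move-a k) (move-b l)) (≡.cong₂ _*_ (move-b k) (move-a l))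
      where
      move-a : ∀ k → δ (π k) (a i) ≡ δ k (a (σ ⟨$⟩ˡ i))
      move-a k = ≡.trans (δ-π k (a i)) (≡.cong (δ k) (liftIdx-a _ i))
      move-b : ∀ k → δ (π k) (b i) ≡ δ k (b (σ ⟨$⟩ˡ i))
      move-b k = ≡.trans (δ-π k (b i)) (≡.cong (δ k) (liftIdx-b _ i))

  swapPlanes : Fin g → Fin g → Idx → Idx
  swapPlanes i j = PlanePermutation.π (transpose i j)

  Respects2 Additive2 : (T2 → A) → Set (c ⊔ ℓ)
  Respects2 ρ = ∀ s t → IsAlt2 s → IsAlt2 t → (∀ k l → s k l ≈ t k l) → ρ s ≈ ρ t
  Additive2 ρ = ∀ s t → IsAlt2 s → IsAlt2 t → ρ (λ k l → s k l + t k l) ≈ ρ s + ρ t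

  Reindex-invariant : (T2 → A) → (Idx → Idx) → Set (c ⊔ ℓ)
  Reindex-invariant ρ π = ∀ t → IsAlt2 t → ρ (λ k l → t (π k) (π l)) ≈ ρ t

  module AdditiveMap (ρ : T2 → A) (respects : Respects2 ρ) (additive : Additive2 ρ) where
    ρ-zero : ρ (λ _ _ → 0#) ≈ 0#
    ρ-zero = x+x≈x⇒x≈0 _ (trans (sym (additive O O alt2-zero alt2-zero))
                                (respects _ O (alt2-cong alt2-zero 0+0≈0) alt2-zero 0+0≈0))
      where
      O : T2
      O _ _ = 0#
      0+0≈0 : ∀ k l → 0# + 0# ≈ 0#
      0+0≈0 _ _ = +-identityˡ 0#

    ρ-sum : ∀ {n} (F : Fin n → T2) → (∀ i → IsAlt2 (F i)) → ρ (λ k l → sum (λ i → F i k l)) ≈ sum (λ i → ρ (F i))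
    ρ-sum {zero}  F _   = ρ-zero
    ρ-sum {suc n} F alt = trans (additive (F zero) _ (alt zero) (alt2-sum (F ∘ suc) (alt ∘ suc)))
                                (+-congˡ (ρ-sum (F ∘ suc) (alt ∘ suc)))

    ρ-θ : ρ θ ≈ sum (λ i → ρ (E i))
    ρ-θ = trans (respects θ _ θ-alt (alt2-sum E E-alt) θ-matrix) (ρ-sum E E-alt)

    ρ-E-swap : ∀ i j → Reindex-invariant ρ (swapPlanes i j) → ρ (E i) ≈ ρ (E j)
    ρ-E-swap i j invariant = begin
      ρ (E i)                       ≈⟨ respects _ _ (E-alt i) (alt2-reindex π {E j} (E-alt j)) E-i≈E-j∘π ⟩
      ρ (λ k l → E j (π k) (π l))   ≈⟨ invariant (E j) (E-alt j) ⟩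
      ρ (E j)                       ∎
      where
      open PlanePermutation (transpose i j)
      E-i≈E-j∘π : ∀ k l → E i k l ≈ E j (π k) (π l)
      E-i≈E-j∘π k l = sym (reflexive (≡.trans (E-reindex j k l) (≡.cong (λ z → E z k l) (transpose-moves j i))))

  _∧₁_ : T2 → H → T3
  (F ∧₁ x) k l m = (F k l * x m + F l m * x k) + F m k * x l

  alt3-of-cyclic : ∀ (w : T3) → (∀ k l m → w k l m ≈ w l m k) → (∀ k m → w k k m ≈ 0#) →
                   (∀ k l m → w k l m ≈ - w l k m) → IsAlt3 w
  alt3-of-cyclic w cyclic diag anti =
      (diag , (λ k m → trans (cyclic k m m) (diag m k)))
    , (anti , (λ k l m → trans (cyclic k l m) (trans (anti l m k) (-‿cong (trans (cyclic m l k) (cyclic l k m))))))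

  ∧₁-alt : ∀ {F : T2} → IsAlt2 F → ∀ (x : H) → IsAlt3 (F ∧₁ x)
  ∧₁-alt {F} (diag , anti) x = alt3-of-cyclic (F ∧₁ x) cyclic vanishes antisymmetric
    where
    flip : ∀ k l y → - (F k l * y) ≈ F l k * y
    flip k l y = trans (-‿distribˡ-* (F k l) y) (*-congʳ (sym (anti l k)))
    cyclic : ∀ k l m → (F ∧₁ x) k l m ≈ (F ∧₁ x) l m k
    cyclic k l m = trans (+-assoc _ _ _) (+-comm (F k l * x m) _)
    vanishes : ∀ k m → (F ∧₁ x) k k m ≈ 0#
    vanishes k m = begin
      (F k k * x m + F k m * x k) + F m k * x k
        ≈⟨ +-cong (+-congʳ (trans (*-congʳ (diag k)) (zeroˡ (x m)))) (sym (flip k m (x k))) ⟩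
      (0# + F k m * x k) - F k m * x k           ≈⟨ +-congʳ (+-identityˡ _) ⟩
      F k m * x k - F k m * x k                  ≈⟨ -‿inverseʳ _ ⟩
      0#                                         ∎
    antisymmetric : ∀ k l m → (F ∧₁ x) k l m ≈ - (F ∧₁ x) l k m
    antisymmetric k l m = begin
      (F k l * x m + F l m * x k) + F m k * x l        ≈⟨ +-CS.xy∙z≈xz∙y _ _ _ ⟩
      (F k l * x m + F m k * x l) + F l m * x k        ≈⟨ sym (-‿involutive _) ⟩
      - - ((F k l * x m + F m k * x l) + F l m * x k)  ≈⟨ -‿cong (sym (trans (+-congʳ (-‿+-comm _ _)) (-‿+-comm _ _))) ⟩
      - ((- (F k l * x m) + - (F m k * x l)) + - (F l m * x k))
        ≈⟨ -‿cong (+-cong (+-cong (flip k l (x m)) (flip m k (x l))) (flip l m (x k))) ⟩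
      - ((F l k * x m + F k m * x l) + F m l * x k)    ∎

  ∧₁-cong : ∀ {F F′ : T2} (x : H) → (∀ k l → F k l ≈ F′ k l) → ∀ k l m → (F ∧₁ x) k l m ≈ (F′ ∧₁ x) k l m
  ∧₁-cong x F≈F′ k l m = +-cong (+-cong (*-congʳ (F≈F′ k l)) (*-congʳ (F≈F′ l m))) (*-congʳ (F≈F′ m k))

  ∧₁-+ : ∀ (s t : T2) (x : H) k l m → ((λ p q → s p q + t p q) ∧₁ x) k l m ≈ (s ∧₁ x) k l m + (t ∧₁ x) k l m
  ∧₁-+ s t x k l m = trans (+-cong (+-cong (distribʳ _ _ _) (distribʳ _ _ _)) (distribʳ _ _ _))
                           (trans (+-congʳ (+-CS.interchange _ _ _ _)) (+-CS.interchange _ _ _ _))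

  ∧₁-zero : ∀ (x : H) k l m → ((λ _ _ → 0#) ∧₁ x) k l m ≈ 0#
  ∧₁-zero x k l m = trans (+-cong (+-cong (zeroˡ (x m)) (zeroˡ (x k))) (zeroˡ (x l)))
                          (trans (+-identityʳ _) (+-identityʳ 0#))

  ∧₁-self : ∀ (u v : H) k l m → ((λ p q → u p * v q - v p * u q) ∧₁ u) k l m ≈ 0#
  ∧₁-self u v k l m = begin
    ((u k * v l - v k * u l) * u m + (u l * v m - v l * u m) * u k) + (u m * v k - v m * u k) * u l
      ≈⟨ +-cong (+-cong ([y-z]x≈yx-zx (u m) (u k * v l) (v k * u l)) ([y-z]x≈yx-zx (u k) (u l * v m) (v l * u m)))
                ([y-z]x≈yx-zx (u l) (u m * v k) (v m * u k)) ⟩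
    ((P₁ - P₂) + (P₃ - (v l * u m) * u k)) + ((u m * v k) * u l - (v m * u k) * u l)
      ≈⟨ +-cong (+-congˡ (+-congˡ (-‿cong (*-CS.xy∙z≈zx∙y (v l) (u m) (u k)))))
                (+-cong (*-CS.xy∙z≈yz∙x (u m) (v k) (u l)) (-‿cong (*-CS.xy∙z≈zx∙y (v m) (u k) (u l)))) ⟩
    ((P₁ - P₂) + (P₃ - P₁)) + (P₂ - P₃)
      ≈⟨ telescope P₁ P₂ P₃ ⟩
    0# ∎
    where
    P₁ P₂ P₃ : A
    P₁ = (u k * v l) * u m
    P₂ = (v k * u l) * u m
    P₃ = (u l * v m) * u k
    telescope : ∀ x y z → ((x - y) + (z - x)) + (y - z) ≈ 0#
    telescope x y z = begin
      ((x - y) + (z - x)) + (y - z)   ≈⟨ +-congʳ (+-comm (x - y) (z - x)) ⟩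
      ((z - x) + (x - y)) + (y - z)   ≈⟨ +-congʳ (+-assoc z (- x) (x - y)) ⟩
      (z + (- x + (x - y))) + (y - z) ≈⟨ +-congʳ (+-congˡ (sym (+-assoc (- x) x (- y)))) ⟩
      (z + ((- x + x) - y)) + (y - z) ≈⟨ +-congʳ (+-congˡ (+-congʳ (-‿inverseˡ x))) ⟩
      (z + (0# - y)) + (y - z)        ≈⟨ +-congʳ (+-congˡ (+-identityˡ (- y))) ⟩
      (z - y) + (y - z)               ≈⟨ +-assoc z (- y) (y - z) ⟩
      z + (- y + (y - z))             ≈⟨ +-congˡ (sym (+-assoc (- y) y (- z))) ⟩
      z + ((- y + y) - z)             ≈⟨ +-congˡ (+-congʳ (-‿inverseˡ y)) ⟩
      z + (0# - z)                    ≈⟨ +-congˡ (+-identityˡ (- z)) ⟩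
      z - z                           ≈⟨ -‿inverseʳ z ⟩
      0#                              ∎

module Necessity2 {c ℓ} (R : CommutativeRing c ℓ) (g : ℕ) (S : Setup.Splits2 R g) where
  open CommutativeRing R renaming (Carrier to A) hiding (zero)
  open RingLemmas R
  open Setup R g
  open Symplectic R g
  open Necessity R g
  open import Relation.Binary.Reasoning.Setoid setoid

  r : T2 → A
  r = proj₁ S

  respects : Respects2 r
  respects = proj₁ (proj₁ (proj₂ S))

  additive : Additive2 r
  additive = proj₁ (proj₂ (proj₁ (proj₂ S)))

  r-θ≈1 : r θ ≈ 1#
  r-θ≈1 = proj₁ (proj₂ (proj₂ S))

  equivariant : ∀ φ τ τ′ → τ * τ′ ≈ 1# → InGSp φ τ → ∀ t → IsAlt2 t → r (act2 φ t) ≈ τ * r t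
  equivariant = proj₂ (proj₂ (proj₂ S))

  -- By equivariance with multiplier 1, r is invariant under plane permutations.
  r-invariant : ∀ σ → Reindex-invariant r (PlanePermutation.π σ)
  r-invariant σ t alt = begin
    r (λ k l → t (π k) (π l))  ≈⟨ respects _ _ (alt2-reindex π alt) (alt2-cong (alt2-reindex π alt) (act2-reindex π t))
                                           (λ k l → sym (act2-reindex π t k l)) ⟩
    r (act2 (reindex π) t)     ≈⟨ equivariant (reindex π) 1# 1# (*-identityʳ 1#) in-GSp t alt ⟩
    1# * r t                   ≈⟨ *-identityˡ (r t) ⟩
    r t                        ∎
    where open PlanePermutation σ

  open AdditiveMap r respects additive

  values-sum : 1# ≈ sum (λ i → r (E i))
  values-sum = trans (sym r-θ≈1) ρ-θ

  values-equal : ∀ i j → r (E i) ≈ r (E j)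
  values-equal i j = ρ-E-swap i j (r-invariant (transpose i j))

module Necessity3 {c ℓ} (R : CommutativeRing c ℓ) (h : ℕ) (S : Setup.Splits3 R (suc h)) where
  open CommutativeRing R renaming (Carrier to A) hiding (zero)
  open RingLemmas R
  open Setup R (suc h)
  open Symplectic R (suc h)
  open Necessity R (suc h)
  open import Relation.Binary.Reasoning.Setoid setoid

  r : T3 → H
  r = proj₁ S

  respects : ∀ s t → IsAlt3 s → IsAlt3 t → (∀ k l m → s k l m ≈ t k l m) → ∀ m → r s m ≈ r t m
  respects = proj₁ (proj₁ (proj₂ S))

  additive : ∀ s t → IsAlt3 s → IsAlt3 t → ∀ m → r (λ k l m → s k l m + t k l m) m ≈ r s m + r t m
  additive = proj₁ (proj₂ (proj₁ (proj₂ S)))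

  retraction : ∀ x m → r (θ∧ x) m ≈ x m
  retraction = proj₁ (proj₂ (proj₂ S))

  equivariant : ∀ φ τ τ′ → τ * τ′ ≈ 1# → InGSp φ τ → ∀ t → IsAlt3 t → ∀ m →
                r (λ k l m → τ′ * act3 φ t k l m) m ≈ act1 φ (r t) m
  equivariant = proj₂ (proj₂ (proj₂ S))

  a₀ : Idx
  a₀ = a zero

  x₀ y₀ : H
  x₀ k = δ k a₀
  y₀ k = δ k (b zero)

  ρ : T2 → A
  ρ F = r (F ∧₁ x₀) a₀

  ρ-respects : Respects2 ρ
  ρ-respects s t alt-s alt-t s≈t = respects _ _ (∧₁-alt alt-s x₀) (∧₁-alt alt-t x₀) (∧₁-cong x₀ s≈t) a₀

  ρ-additive : Additive2 ρ
  ρ-additive s t alt-s alt-t =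
    trans (respects _ _ alt-sum (alt3-cong alt-sum (λ k l m → sym (∧₁-+ s t x₀ k l m))) (∧₁-+ s t x₀) a₀)
          (additive _ _ (∧₁-alt alt-s x₀) (∧₁-alt alt-t x₀) a₀)
    where
    alt-sum : IsAlt3 ((λ k l → s k l + t k l) ∧₁ x₀)
    alt-sum = ∧₁-alt (alt2-+ alt-s alt-t) x₀

  open AdditiveMap ρ ρ-respects ρ-additive

  ρ-θ≈1 : ρ θ ≈ 1#
  ρ-θ≈1 = trans (retraction x₀ a₀) (reflexive (δ-diag a₀))

  -- E 0 ∧ a₀ = a₀ ∧ b₀ ∧ a₀ = 0.
  ρ-E₀≈0 : ρ (E zero) ≈ 0#
  ρ-E₀≈0 = trans (respects _ _ (∧₁-alt (E-alt zero) x₀) (∧₁-alt alt2-zero x₀) both-vanish a₀) ρ-zero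
    where
    both-vanish : ∀ k l m → (E zero ∧₁ x₀) k l m ≈ ((λ _ _ → 0#) ∧₁ x₀) k l m
    both-vanish k l m = trans (∧₁-self x₀ y₀ k l m) (sym (∧₁-zero x₀ k l m))

  -- Exchanging two planes other than 0 fixes a₀, hence commutes with ∧ a₀.
  ρ-invariant : ∀ i j → Reindex-invariant ρ (swapPlanes (suc i) (suc j))
  ρ-invariant i j t alt = begin
    r ((λ k l → t (π k) (π l)) ∧₁ x₀) a₀
      ≈⟨ respects _ _ (∧₁-alt alt∘π x₀) (alt3-cong (∧₁-alt alt∘π x₀) (λ k l m → sym (reindexed k l m)))
                  reindexed a₀ ⟩
    r (λ k l m → 1# * act3 (reindex π) (t ∧₁ x₀) k l m) a₀
      ≈⟨ equivariant (reindex π) 1# 1# (*-identityʳ 1#) in-GSp (t ∧₁ x₀) (∧₁-alt alt x₀) a₀ ⟩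
    act1 (reindex π) (r (t ∧₁ x₀)) a₀
      ≈⟨ act1-reindex π (r (t ∧₁ x₀)) a₀ ⟩
    r (t ∧₁ x₀) (π a₀)
      ≈⟨ reflexive (≡.cong (r (t ∧₁ x₀)) (liftIdx-a (PC.transpose (suc i) (suc j)) zero)) ⟩
    r (t ∧₁ x₀) a₀ ∎
    where
    open PlanePermutation (transpose (suc i) (suc j))
    alt∘π : IsAlt2 (λ k l → t (π k) (π l))
    alt∘π = alt2-reindex π alt
    x₀-fixed : ∀ k → x₀ (π k) ≡ x₀ k
    x₀-fixed k = ≡.trans (δ-π k a₀) (≡.cong (δ k) (liftIdx-a (PC.transpose (suc j) (suc i)) zero))
    reindexed : ∀ k l m → ((λ k l → t (π k) (π l)) ∧₁ x₀) k l m ≈ 1# * act3 (reindex π) (t ∧₁ x₀) k l m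
    reindexed k l m = sym (trans (*-identityˡ _) (trans (act3-reindex π (t ∧₁ x₀) k l m)
      (reflexive (≡.cong₂ _+_ (≡.cong₂ _+_ (≡.cong (t (π k) (π l) *_) (x₀-fixed m))
                                           (≡.cong (t (π l) (π m) *_) (x₀-fixed k)))
                              (≡.cong (t (π m) (π k) *_) (x₀-fixed l))))))

  values-sum : 1# ≈ sum (λ j → ρ (E (suc j)))
  values-sum = begin
    1#                                              ≈⟨ sym ρ-θ≈1 ⟩
    ρ θ                                             ≈⟨ ρ-θ ⟩
    ρ (E zero) + sum (λ j → ρ (E (suc j)))          ≈⟨ +-congʳ ρ-E₀≈0 ⟩
    0# + sum (λ j → ρ (E (suc j)))                  ≈⟨ +-identityˡ _ ⟩
    sum (λ j → ρ (E (suc j)))                       ∎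

  values-equal : ∀ i j → ρ (E (suc i)) ≈ ρ (E (suc j))
  values-equal i j = ρ-E-swap (suc i) (suc j) (ρ-invariant i j)

-- The two necessity statements; only 1 ≉ 0 is used.
module UnitFromSplitting {c ℓ} (R : CommutativeRing c ℓ)
  (1≉0 : ¬ (CommutativeRing._≈_ R (CommutativeRing.1# R) (CommutativeRing.0# R))) where
  open CommutativeRing R renaming (Carrier to A) hiding (zero)
  open RingNotions R using (IsUnit; nat)
  open RingLemmas R
  open import Relation.Binary.Reasoning.Setoid setoid

  -- g r(E 0) = Σ_i r(E i) = 1 (and g = 0 would force 1 = 0).
  splits2⇒unit : ∀ g → Setup.Splits2 R g → IsUnit (nat g)
  splits2⇒unit zero    S = ⊥-elim (1≉0 values-sum)
    where open Necessity2 R zero S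
  splits2⇒unit (suc h) S = r (E zero) , (begin
    nat (suc h) * r (E zero)        ≈⟨ sym (sum-const (suc h) (r (E zero))) ⟩
    sum {suc h} (λ _ → r (E zero))  ≈⟨ sym (sum-cong-≋ (λ i → values-equal i zero)) ⟩
    sum (λ i → r (E i))             ≈⟨ sym values-sum ⟩
    1#                              ∎)
    where
    open Symplectic R (suc h) using (E)
    open Necessity2 R (suc h) S

  -- (g - 1) ρ(E 1) = Σ_j ρ(E (j+1)) = 1; for g = 0, g - 1 = -1 is a unit
  -- and g = 1 would force 1 = 0.
  splits3⇒unit : ∀ g → Setup.Splits3 R g → IsUnit (nat g - 1#)
  splits3⇒unit zero          _ = - 1# , trans (*-congʳ (+-identityˡ (- 1#))) (trans (-1*x≈-x (- 1#)) (-‿involutive 1#))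
  splits3⇒unit (suc zero)    S = ⊥-elim (1≉0 values-sum)
    where open Necessity3 R zero S
  splits3⇒unit (suc (suc h)) S = ρ (E (suc zero)) , (begin
    (nat (suc (suc h)) - 1#) * ρ (E (suc zero))  ≈⟨ *-congʳ (xyx⁻¹≈y 1# (nat (suc h))) ⟩
    nat (suc h) * ρ (E (suc zero))               ≈⟨ sym (sum-const (suc h) (ρ (E (suc zero)))) ⟩
    sum {suc h} (λ _ → ρ (E (suc zero)))         ≈⟨ sym (sum-cong-≋ (λ j → values-equal j zero)) ⟩
    sum (λ j → ρ (E (suc j)))                    ≈⟨ sym values-sum ⟩
    1#                                           ∎)
    where
    open Symplectic R (suc (suc h)) using (E)
    open Necessity3 R (suc h) S

lemma9p4 : ∀ {c ℓ} (R : CommutativeRing c ℓ) →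
    RingNotions.IsIntegralDomain R → RingNotions.CharZero R → (g : ℕ) →
    (Setup.Splits2 R g ⇔ RingNotions.IsUnit R (RingNotions.nat R g))
    × (Setup.Splits3 R g ⇔ RingNotions.IsUnit R (CommutativeRing._-_ R (RingNotions.nat R g) (CommutativeRing.1# R)))
lemma9p4 R dom char0 g =
    mk⇔ (splits2⇒unit g) (unit⇒splits2)
  , mk⇔ (splits3⇒unit g) (unit⇒splits3)
  where
  open UnitFromSplitting R (proj₁ dom)
  open Sufficiency R dom char0 g
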